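{- The reduction $\longrightarrow$ of the untyped computational $\lambda$-calculus $\lambda_c^u$ is Church–Rosser: for all computations $M,N,L$, if $M\longrightarrow^* N$ and $M\longrightarrow^* L$, then there exists a computation $M'$ with $N\longrightarrow^* M'$ and $L\longrightarrow^* M'$.
   Context: The calculus $\lambda_c^u$ has two sorts of expressions over a denumerable set of variables $x$: values $V,W ::= x \mid \lambda x.M$ and computations $M,N ::= \mathit{unit}\,V \mid M\star V$ (terms are identified up to renaming of bound variables; $M[V/x]$ is capture-avoiding substitution; $FV$ denotes free variables). The notion of reduction $\lambda\mathbf{C}=\beta_c\cup \mathit{id}\cup \mathit{ass}$ consists of the pairs of computations: $(\beta_c)$ $\mathit{unit}\,V\star(\lambda x.M) \mapsto M[V/x]$; $(\mathit{id})$ $M\star \lambda x.\mathit{unit}\,x \mapsto M$; $(\mathit{ass})$ $(L\star\lambda x.M)\star\lambda y.N \mapsto L\star \lambda x.(M\star\lambda y.N)$ provided $x\notin FV(N)$. Value contexts are $\mathcal V ::= [\cdot]_D \mid \lambda x.\mathcal C$ and computation contexts are $\mathcal C ::= [\cdot]_{TD}\mid \mathit{unit}\,\mathcal V \mid \mathcal C\star V \mid M\star \mathcal V$ (holes filled by values resp. computations, possibly capturing variables). The one-step reduction $\longrightarrow$ is the compatible closure of $\lambda\mathbf C$: if $(M,M')\in\lambda\mathbf C$ then $\mathcal C[M]\longrightarrow \mathcal C[M']$ for every computation context $\mathcal C$. $\longrightarrow^*$ is its reflexive–transitive closure. -}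

module Defs where

open import Data.Nat using (ℕ; zero; suc)
open import Data.Fin using (Fin; zero; suc)
open import Data.Product using (∃; _×_)
open import Relation.Binary.Construct.Closure.ReflexiveTransitive using (Star)

-- Untyped computational lambda calculus λ_c^u, terms up to alpha-equivalence
-- rendered with well-scoped de Bruijn indices: Val n / Comp n have at most
-- n free variables.

mutual
  data Val (n : ℕ) : Set where
    var : Fin n → Val n
    ƛ_  : Comp (suc n) → Val n

  data Comp (n : ℕ) : Set where
    unit : Val n → Comp n
    _⋆_  : Comp n → Val n → Comp n

infixl 5 _⋆_

Ren : ℕ → ℕ → Set
Ren m n = Fin m → Fin n

liftR : ∀ {m n} → Ren m n → Ren (suc m) (suc n)
liftR ρ zero    = zero
liftR ρ (suc i) = suc (ρ i)

mutual
  renV : ∀ {m n} → Ren m n → Val m → Val n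
  renV ρ (var i) = var (ρ i)
  renV ρ (ƛ M)   = ƛ (renC (liftR ρ) M)

  renC : ∀ {m n} → Ren m n → Comp m → Comp n
  renC ρ (unit V) = unit (renV ρ V)
  renC ρ (M ⋆ V)  = renC ρ M ⋆ renV ρ V

Sub : ℕ → ℕ → Set
Sub m n = Fin m → Val n

liftS : ∀ {m n} → Sub m n → Sub (suc m) (suc n)
liftS σ zero    = var zero
liftS σ (suc i) = renV suc (σ i)

mutual
  subV : ∀ {m n} → Sub m n → Val m → Val n
  subV σ (var i) = σ i
  subV σ (ƛ M)   = ƛ (subC (liftS σ) M)

  subC : ∀ {m n} → Sub m n → Comp m → Comp n
  subC σ (unit V) = unit (subV σ V)
  subC σ (M ⋆ V)  = subC σ M ⋆ subV σ V

single : ∀ {n} → Val n → Sub (suc n) n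
single V zero    = V
single V (suc i) = var i

_[_] : ∀ {n} → Comp (suc n) → Val n → Comp n
M [ V ] = subC (single V) M

-- weakening that skips the variable at index 1 (the x of rule ass):
-- N lives under binder y (index 0); in the reduct it is placed under x and y,
-- so x ∉ FV(N) holds by construction.
skip1 : ∀ {n} → Ren (suc n) (suc (suc n))
skip1 = liftR suc

data _↦_ {n : ℕ} : Comp n → Comp n → Set where
  βc  : ∀ (V : Val n) (M : Comp (suc n)) → (unit V ⋆ (ƛ M)) ↦ (M [ V ])
  id  : ∀ (M : Comp n) → (M ⋆ (ƛ unit (var zero))) ↦ M
  ass : ∀ (L : Comp n) (M : Comp (suc n)) (N : Comp (suc n)) →
        ((L ⋆ (ƛ M)) ⋆ (ƛ N)) ↦ (L ⋆ (ƛ (M ⋆ (ƛ renC skip1 N))))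

mutual
  data _⟶_ {n : ℕ} : Comp n → Comp n → Set where
    root  : ∀ {M M'} → M ↦ M' → M ⟶ M'
    unitV : ∀ {V V'} → V ⟶V V' → unit V ⟶ unit V'
    ⋆L    : ∀ {M M' V} → M ⟶ M' → (M ⋆ V) ⟶ (M' ⋆ V)
    ⋆R    : ∀ {M V V'} → V ⟶V V' → (M ⋆ V) ⟶ (M ⋆ V')

  data _⟶V_ {n : ℕ} : Val n → Val n → Set where
    ƛcong : ∀ {M M' : Comp (suc n)} → M ⟶ M' → (ƛ M) ⟶V (ƛ M')

_⟶*_ : ∀ {n} → Comp n → Comp n → Set
_⟶*_ = Star _⟶_

-- The reduction is the union of the associativity steps and the β_c/id steps.
-- Associativity is confluent since every term ass-reduces to an ass-normal
-- form that ass-steps preserve. β_c ∪ id is confluent by the Z-property of its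
-- complete development. An ass-step and a β_c/id-step out of one term are
-- joined by a single β_c/id-step after the ass-step, so the two reductions
-- commute, and the Hindley–Rosen lemma makes their union confluent.

module Submission where

open import Data.Bool using (Bool; true; false)
open import Data.Empty using (⊥; ⊥-elim)
open import Data.Fin using (Fin; zero; suc)
open import Data.Nat using (ℕ; zero; suc)
open import Data.Product using (∃; _×_; _,_; -,_; proj₁; proj₂)
open import Data.Sum as Sum using (_⊎_; inj₁; inj₂; [_,_])
open import Function using (_∘_)
open import Level using (Level)
open import Relation.Binary.Core using (Rel; _⇒_)
open import Relation.Binary.Construct.Union using (_∪_)
open import Relation.Binary.Construct.Closure.ReflexiveTransitive
  using (Star; ε; _◅_; _◅◅_; gmap; map; fold; concat; kleisliStar; return)
open import Relation.Binary.Rewriting using (Confluent)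
open import Relation.Binary.PropositionalEquality
  using (_≡_; refl; sym; trans; cong; cong₂; subst; _≗_; module ≡-Reasoning)

open import Defs

-- Abstract rewriting

module _ {a : Level} {A : Set a} where

  Diamond : ∀ {ℓ} → Rel A ℓ → Set _
  Diamond _⟶_ = ∀ {x y z} → x ⟶ y → x ⟶ z → ∃ λ w → (y ⟶ w) × (z ⟶ w)

  Commute : ∀ {ℓ₁ ℓ₂} → Rel A ℓ₁ → Rel A ℓ₂ → Set _
  Commute R S = ∀ {x y z} → Star R x y → Star S x z → ∃ λ w → Star S y w × Star R z w

  ZProperty : ∀ {ℓ} → Rel A ℓ → (A → A) → Set _
  ZProperty _⟶_ f = ∀ {x y} → x ⟶ y → Star _⟶_ y (f x) × Star _⟶_ (f x) (f y)

  module _ {ℓ} {_⟶_ : Rel A ℓ} (◇ : Diamond _⟶_) where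

    strip : ∀ {x y z} → x ⟶ y → Star _⟶_ x z → ∃ λ w → Star _⟶_ y w × (z ⟶ w)
    strip s ε = -, ε , s
    strip s (t ◅ ts) with ◇ s t
    ... | _ , s′ , t′ with strip t′ ts
    ... | _ , ss , u = -, s′ ◅ ss , u

    diamond⇒confluent : Confluent _⟶_
    diamond⇒confluent ε q = -, q , ε
    diamond⇒confluent (s ◅ ss) q with strip s q
    ... | _ , q′ , s′ with diamond⇒confluent ss q′
    ... | _ , u , v = -, u , s′ ◅ v

  confluent-between : ∀ {ℓ₁ ℓ₂} {R : Rel A ℓ₁} {S : Rel A ℓ₂} →
                      R ⇒ S → S ⇒ Star R → Confluent S → Confluent R
  confluent-between R⊆S S⊆R* conf p q with conf (map R⊆S p) (map R⊆S q)
  ... | w , u , v = w , concat (map S⊆R* u) , concat (map S⊆R* v)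

  -- The relation  x ▹ y := x ⟶* y ⟶* f x  sits between ⟶ and ⟶*, and has
  -- the diamond property with f x as the common reduct.
  z-property⇒confluent : ∀ {ℓ} {_⟶_ : Rel A ℓ} (f : A → A) → ZProperty _⟶_ f → Confluent _⟶_
  z-property⇒confluent {_⟶_ = _⟶_} f z =
    confluent-between (λ s → return s , proj₁ (z s)) proj₁ (diamond⇒confluent ◇)
    where
    _▹_ : Rel A _
    x ▹ y = Star _⟶_ x y × Star _⟶_ y (f x)

    f-mono* : ∀ {x y} → Star _⟶_ x y → Star _⟶_ (f x) (f y)
    f-mono* = kleisliStar f (proj₂ ∘ z)

    ◇ : Diamond _▹_
    ◇ {x} (p , p′) (q , q′) = f x , (p′ , f-mono* p) , (q′ , f-mono* q)

  hindley-rosen : ∀ {ℓ₁ ℓ₂} {R : Rel A ℓ₁} {S : Rel A ℓ₂} →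
                  Confluent R → Confluent S → Commute R S → Confluent (R ∪ S)
  hindley-rosen {R = R} {S} conf-R conf-S com =
    confluent-between [ inj₁ ∘ return , inj₂ ∘ return ] [ map inj₁ , map inj₂ ]
                      (diamond⇒confluent ◇)
    where
    ◇ : Diamond (Star R ∪ Star S)
    ◇ (inj₁ p) (inj₁ q) = let w , u , v = conf-R p q in w , inj₁ u , inj₁ v
    ◇ (inj₂ p) (inj₂ q) = let w , u , v = conf-S p q in w , inj₂ u , inj₂ v
    ◇ (inj₁ p) (inj₂ q) = let w , u , v = com p q in w , inj₂ u , inj₁ v
    ◇ (inj₂ p) (inj₁ q) = let w , u , v = com q p in w , inj₁ v , inj₂ u

  commute-by-strip : ∀ {ℓ₁ ℓ₂} {R : Rel A ℓ₁} {S : Rel A ℓ₂} →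
                     (∀ {x y z} → R x y → S x z → ∃ λ w → S y w × Star R z w) →
                     Commute R S
  commute-by-strip {R = R} {S} one = many
    where
    strip* : ∀ {x y z} → Star R x y → S x z → ∃ λ w → S y w × Star R z w
    strip* ε s = -, s , ε
    strip* (r ◅ rs) s with one r s
    ... | _ , s′ , p with strip* rs s′
    ... | _ , s″ , q = -, s″ , p ◅◅ q

    many : Commute R S
    many rs ε = -, ε , rs
    many rs (s ◅ ss) with strip* rs s
    ... | _ , s′ , p with many p ss
    ... | _ , u , v = -, s′ ◅ u , v

  confluent-by-normal-form : ∀ {ℓ} {R : Rel A ℓ} (nf : A → A) →
                             (∀ x → Star R x (nf x)) → (∀ {x y} → R x y → nf x ≡ nf y) →
                             Confluent R
  confluent-by-normal-form {R = R} nf reaches invariant {x} {y} {z} p q =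
    nf x , subst (Star R y) (sym (invariant* p)) (reaches y)
         , subst (Star R z) (sym (invariant* q)) (reaches z)
    where
    invariant* : ∀ {x y} → Star R x y → nf x ≡ nf y
    invariant* = fold (λ x y → nf x ≡ nf y) (trans ∘ invariant) refl

liftR-ext : ∀ {m n} {ρ ρ′ : Ren m n} → ρ ≗ ρ′ → liftR ρ ≗ liftR ρ′
liftR-ext e zero    = refl
liftR-ext e (suc i) = cong suc (e i)

mutual
  renV-ext : ∀ {m n} {ρ ρ′ : Ren m n} → ρ ≗ ρ′ → ∀ V → renV ρ V ≡ renV ρ′ V
  renV-ext e (var i) = cong var (e i)
  renV-ext e (ƛ M)   = cong ƛ_ (renC-ext (liftR-ext e) M)

  renC-ext : ∀ {m n} {ρ ρ′ : Ren m n} → ρ ≗ ρ′ → ∀ M → renC ρ M ≡ renC ρ′ M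
  renC-ext e (unit V) = cong unit (renV-ext e V)
  renC-ext e (M ⋆ V)  = cong₂ _⋆_ (renC-ext e M) (renV-ext e V)

liftS-ext : ∀ {m n} {σ σ′ : Sub m n} → σ ≗ σ′ → liftS σ ≗ liftS σ′
liftS-ext e zero    = refl
liftS-ext e (suc i) = cong (renV suc) (e i)

mutual
  subV-ext : ∀ {m n} {σ σ′ : Sub m n} → σ ≗ σ′ → ∀ V → subV σ V ≡ subV σ′ V
  subV-ext e (var i) = e i
  subV-ext e (ƛ M)   = cong ƛ_ (subC-ext (liftS-ext e) M)

  subC-ext : ∀ {m n} {σ σ′ : Sub m n} → σ ≗ σ′ → ∀ M → subC σ M ≡ subC σ′ M
  subC-ext e (unit V) = cong unit (subV-ext e V)
  subC-ext e (M ⋆ V)  = cong₂ _⋆_ (subC-ext e M) (subV-ext e V)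

liftR-∘ : ∀ {l m n} (ρ : Ren m n) (ρ′ : Ren l m) → liftR ρ ∘ liftR ρ′ ≗ liftR (ρ ∘ ρ′)
liftR-∘ ρ ρ′ zero    = refl
liftR-∘ ρ ρ′ (suc i) = refl

mutual
  renV-renV : ∀ {l m n} (ρ : Ren m n) (ρ′ : Ren l m) V → renV ρ (renV ρ′ V) ≡ renV (ρ ∘ ρ′) V
  renV-renV ρ ρ′ (var i) = refl
  renV-renV ρ ρ′ (ƛ M)   =
    cong ƛ_ (trans (renC-renC (liftR ρ) (liftR ρ′) M) (renC-ext (liftR-∘ ρ ρ′) M))

  renC-renC : ∀ {l m n} (ρ : Ren m n) (ρ′ : Ren l m) M → renC ρ (renC ρ′ M) ≡ renC (ρ ∘ ρ′) M
  renC-renC ρ ρ′ (unit V) = cong unit (renV-renV ρ ρ′ V)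
  renC-renC ρ ρ′ (M ⋆ V)  = cong₂ _⋆_ (renC-renC ρ ρ′ M) (renV-renV ρ ρ′ V)

liftS-var∘ : ∀ {m n} (ρ : Ren m n) → liftS (var ∘ ρ) ≗ var ∘ liftR ρ
liftS-var∘ ρ zero    = refl
liftS-var∘ ρ (suc i) = refl

mutual
  renV-as-subV : ∀ {m n} (ρ : Ren m n) V → renV ρ V ≡ subV (var ∘ ρ) V
  renV-as-subV ρ (var i) = refl
  renV-as-subV ρ (ƛ M)   =
    cong ƛ_ (trans (renC-as-subC (liftR ρ) M) (sym (subC-ext (liftS-var∘ ρ) M)))

  renC-as-subC : ∀ {m n} (ρ : Ren m n) M → renC ρ M ≡ subC (var ∘ ρ) M
  renC-as-subC ρ (unit V) = cong unit (renV-as-subV ρ V)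
  renC-as-subC ρ (M ⋆ V)  = cong₂ _⋆_ (renC-as-subC ρ M) (renV-as-subV ρ V)

liftS-∘-liftR : ∀ {l m n} (σ : Sub m n) (ρ : Ren l m) → liftS σ ∘ liftR ρ ≗ liftS (σ ∘ ρ)
liftS-∘-liftR σ ρ zero    = refl
liftS-∘-liftR σ ρ (suc i) = refl

mutual
  subV-renV : ∀ {l m n} (σ : Sub m n) (ρ : Ren l m) V → subV σ (renV ρ V) ≡ subV (σ ∘ ρ) V
  subV-renV σ ρ (var i) = refl
  subV-renV σ ρ (ƛ M)   =
    cong ƛ_ (trans (subC-renC (liftS σ) (liftR ρ) M) (subC-ext (liftS-∘-liftR σ ρ) M))

  subC-renC : ∀ {l m n} (σ : Sub m n) (ρ : Ren l m) M → subC σ (renC ρ M) ≡ subC (σ ∘ ρ) M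
  subC-renC σ ρ (unit V) = cong unit (subV-renV σ ρ V)
  subC-renC σ ρ (M ⋆ V)  = cong₂ _⋆_ (subC-renC σ ρ M) (subV-renV σ ρ V)

liftR-∘-liftS : ∀ {l m n} (ρ : Ren m n) (σ : Sub l m) →
                renV (liftR ρ) ∘ liftS σ ≗ liftS (renV ρ ∘ σ)
liftR-∘-liftS ρ σ zero    = refl
liftR-∘-liftS ρ σ (suc i) = trans (renV-renV (liftR ρ) suc (σ i)) (sym (renV-renV suc ρ (σ i)))

mutual
  renV-subV : ∀ {l m n} (ρ : Ren m n) (σ : Sub l m) V → renV ρ (subV σ V) ≡ subV (renV ρ ∘ σ) V
  renV-subV ρ σ (var i) = refl
  renV-subV ρ σ (ƛ M)   =
    cong ƛ_ (trans (renC-subC (liftR ρ) (liftS σ) M) (subC-ext (liftR-∘-liftS ρ σ) M))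

  renC-subC : ∀ {l m n} (ρ : Ren m n) (σ : Sub l m) M → renC ρ (subC σ M) ≡ subC (renV ρ ∘ σ) M
  renC-subC ρ σ (unit V) = cong unit (renV-subV ρ σ V)
  renC-subC ρ σ (M ⋆ V)  = cong₂ _⋆_ (renC-subC ρ σ M) (renV-subV ρ σ V)

liftS-∘-liftS : ∀ {l m n} (τ : Sub m n) (σ : Sub l m) →
                subV (liftS τ) ∘ liftS σ ≗ liftS (subV τ ∘ σ)
liftS-∘-liftS τ σ zero    = refl
liftS-∘-liftS τ σ (suc i) = trans (subV-renV (liftS τ) suc (σ i)) (sym (renV-subV suc τ (σ i)))

mutual
  subV-subV : ∀ {l m n} (τ : Sub m n) (σ : Sub l m) V → subV τ (subV σ V) ≡ subV (subV τ ∘ σ) V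
  subV-subV τ σ (var i) = refl
  subV-subV τ σ (ƛ M)   =
    cong ƛ_ (trans (subC-subC (liftS τ) (liftS σ) M) (subC-ext (liftS-∘-liftS τ σ) M))

  subC-subC : ∀ {l m n} (τ : Sub m n) (σ : Sub l m) M → subC τ (subC σ M) ≡ subC (subV τ ∘ σ) M
  subC-subC τ σ (unit V) = cong unit (subV-subV τ σ V)
  subC-subC τ σ (M ⋆ V)  = cong₂ _⋆_ (subC-subC τ σ M) (subV-subV τ σ V)

liftS-var : ∀ {n} → liftS {n} var ≗ var
liftS-var zero    = refl
liftS-var (suc i) = refl

mutual
  subV-var : ∀ {n} (V : Val n) → subV var V ≡ V
  subV-var (var i) = refl
  subV-var (ƛ M)   = cong ƛ_ (trans (subC-ext liftS-var M) (subC-var M))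

  subC-var : ∀ {n} (M : Comp n) → subC var M ≡ M
  subC-var (unit V) = cong unit (subV-var V)
  subC-var (M ⋆ V)  = cong₂ _⋆_ (subC-var M) (subV-var V)

subC-renC-cancel : ∀ {m n} {σ : Sub n m} {ρ : Ren m n} → σ ∘ ρ ≗ var → ∀ M → subC σ (renC ρ M) ≡ M
subC-renC-cancel {σ = σ} {ρ} e M = trans (subC-renC σ ρ M) (trans (subC-ext e M) (subC-var M))

liftS-single-skip1 : ∀ {n} (W : Val n) (N : Comp (suc n)) → subC (liftS (single W)) (renC skip1 N) ≡ N
liftS-single-skip1 W = subC-renC-cancel λ { zero → refl ; (suc i) → refl }

skip1-[var0] : ∀ {n} (N : Comp (suc n)) → renC skip1 N [ var zero ] ≡ N
skip1-[var0] = subC-renC-cancel λ { zero → refl ; (suc i) → refl }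

subC-[] : ∀ {m n} (σ : Sub m n) (V : Val m) (M : Comp (suc m)) →
          subC σ (M [ V ]) ≡ subC (liftS σ) M [ subV σ V ]
subC-[] σ V M = trans (subC-subC σ (single V) M) (trans (subC-ext pointwise M) (sym (subC-subC _ _ M)))
  where
  pointwise : subV σ ∘ single V ≗ subV (single (subV σ V)) ∘ liftS σ
  pointwise zero    = refl
  pointwise (suc i) = sym (trans (subV-renV _ suc (σ i)) (subV-var (σ i)))

renC-[] : ∀ {m n} (ρ : Ren m n) (V : Val m) (M : Comp (suc m)) →
          renC ρ (M [ V ]) ≡ renC (liftR ρ) M [ renV ρ V ]
renC-[] ρ V M = trans (renC-subC ρ _ M) (trans (subC-ext pointwise M) (sym (subC-renC _ _ M)))
  where
  pointwise : renV ρ ∘ single V ≗ single (renV ρ V) ∘ liftR ρ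
  pointwise zero    = refl
  pointwise (suc i) = refl

subC-skip1 : ∀ {m n} (σ : Sub m n) (N : Comp (suc m)) →
             subC (liftS (liftS σ)) (renC skip1 N) ≡ renC skip1 (subC (liftS σ) N)
subC-skip1 σ N = trans (subC-renC _ _ N) (trans (subC-ext pointwise N) (sym (renC-subC _ _ N)))
  where
  pointwise : liftS (liftS σ) ∘ skip1 ≗ renV skip1 ∘ liftS σ
  pointwise zero    = refl
  pointwise (suc i) = trans (renV-renV suc suc (σ i)) (sym (renV-renV skip1 suc (σ i)))

renC-skip1 : ∀ {m n} (ρ : Ren m n) (N : Comp (suc m)) →
             renC (liftR (liftR ρ)) (renC skip1 N) ≡ renC skip1 (renC (liftR ρ) N)
renC-skip1 ρ N =
  trans (renC-renC _ _ N) (trans (renC-ext pointwise N) (sym (renC-renC _ _ N)))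
  where
  pointwise : liftR (liftR ρ) ∘ skip1 ≗ skip1 ∘ liftR ρ
  pointwise zero    = refl
  pointwise (suc i) = refl

RootRel : Set₁
RootRel = ∀ {n} → Comp n → Comp n → Set

mutual
  data Compat (R : RootRel) {n : ℕ} : Comp n → Comp n → Set where
    root  : ∀ {M M′} → R M M′ → Compat R M M′
    unitV : ∀ {V V′} → Compatᵛ R V V′ → Compat R (unit V) (unit V′)
    ⋆L    : ∀ {M M′ V} → Compat R M M′ → Compat R (M ⋆ V) (M′ ⋆ V)
    ⋆R    : ∀ {M V V′} → Compatᵛ R V V′ → Compat R (M ⋆ V) (M ⋆ V′)

  data Compatᵛ (R : RootRel) {n : ℕ} : Val n → Val n → Set where
    ƛcong : ∀ {M M′ : Comp (suc n)} → Compat R M M′ → Compatᵛ R (ƛ M) (ƛ M′)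

infix 4 _⟶[_]*_ _⟶ᵛ[_]*_

_⟶[_]*_ : ∀ {n} → Comp n → RootRel → Comp n → Set
M ⟶[ R ]* M′ = Star (Compat R) M M′

_⟶ᵛ[_]*_ : ∀ {n} → Val n → RootRel → Val n → Set
V ⟶ᵛ[ R ]* V′ = Star (Compatᵛ R) V V′

module _ {R : RootRel} {n : ℕ} where

  unit* : {V V′ : Val n} → V ⟶ᵛ[ R ]* V′ → unit V ⟶[ R ]* unit V′
  unit* = gmap unit unitV

  ⋆L* : {M M′ : Comp n} {V : Val n} → M ⟶[ R ]* M′ → M ⋆ V ⟶[ R ]* M′ ⋆ V
  ⋆L* = gmap _ ⋆L

  ⋆R* : {M : Comp n} {V V′ : Val n} → V ⟶ᵛ[ R ]* V′ → M ⋆ V ⟶[ R ]* M ⋆ V′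
  ⋆R* = gmap _ ⋆R

  ⋆* : {M M′ : Comp n} {V V′ : Val n} → M ⟶[ R ]* M′ → V ⟶ᵛ[ R ]* V′ → M ⋆ V ⟶[ R ]* M′ ⋆ V′
  ⋆* p q = ⋆L* p ◅◅ ⋆R* q

  ƛ* : {M M′ : Comp (suc n)} → M ⟶[ R ]* M′ → ƛ M ⟶ᵛ[ R ]* ƛ M′
  ƛ* = gmap ƛ_ ƛcong

  ≡⇒⟶* : {M M′ : Comp n} → M ≡ M′ → M ⟶[ R ]* M′
  ≡⇒⟶* refl = ε

SubstClosed : RootRel → Set
SubstClosed R = ∀ {m n} (σ : Sub m n) {M M′ : Comp m} → R M M′ → R (subC σ M) (subC σ M′)

module SubstClosure {R : RootRel} (R-subst : SubstClosed R) where

  mutual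
    subC-step : ∀ {m n} (σ : Sub m n) {M M′} → Compat R M M′ → Compat R (subC σ M) (subC σ M′)
    subC-step σ (root r)  = root (R-subst σ r)
    subC-step σ (unitV s) = unitV (subV-step σ s)
    subC-step σ (⋆L s)    = ⋆L (subC-step σ s)
    subC-step σ (⋆R s)    = ⋆R (subV-step σ s)

    subV-step : ∀ {m n} (σ : Sub m n) {V V′} → Compatᵛ R V V′ → Compatᵛ R (subV σ V) (subV σ V′)
    subV-step σ (ƛcong s) = ƛcong (subC-step (liftS σ) s)

  subC-steps : ∀ {m n} (σ : Sub m n) {M M′} → M ⟶[ R ]* M′ → subC σ M ⟶[ R ]* subC σ M′
  subC-steps σ = gmap (subC σ) (subC-step σ)

  renC-step : ∀ {m n} (ρ : Ren m n) {M M′} → Compat R M M′ → Compat R (renC ρ M) (renC ρ M′)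
  renC-step ρ {M} {M′} s rewrite renC-as-subC ρ M | renC-as-subC ρ M′ = subC-step (var ∘ ρ) s

  renV-steps : ∀ {m n} (ρ : Ren m n) {V V′} → V ⟶ᵛ[ R ]* V′ → renV ρ V ⟶ᵛ[ R ]* renV ρ V′
  renV-steps ρ = gmap (renV ρ) λ { (ƛcong s) → ƛcong (renC-step (liftR ρ) s) }

  mutual
    subC-pointwise : ∀ {m n} {σ τ : Sub m n} → (∀ i → σ i ⟶ᵛ[ R ]* τ i) →
                     ∀ M → subC σ M ⟶[ R ]* subC τ M
    subC-pointwise h (unit V) = unit* (subV-pointwise h V)
    subC-pointwise h (M ⋆ V)  = ⋆* (subC-pointwise h M) (subV-pointwise h V)

    subV-pointwise : ∀ {m n} {σ τ : Sub m n} → (∀ i → σ i ⟶ᵛ[ R ]* τ i) →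
                     ∀ V → subV σ V ⟶ᵛ[ R ]* subV τ V
    subV-pointwise h (var i) = h i
    subV-pointwise {σ = σ} {τ} h (ƛ M) = ƛ* (subC-pointwise lifted M)
      where
      lifted : ∀ i → liftS σ i ⟶ᵛ[ R ]* liftS τ i
      lifted zero    = ε
      lifted (suc i) = renV-steps suc (h i)

  []-argument : ∀ {n} (M : Comp (suc n)) {V V′ : Val n} → V ⟶ᵛ[ R ]* V′ → M [ V ] ⟶[ R ]* M [ V′ ]
  []-argument M p = subC-pointwise (λ { zero → p ; (suc i) → ε }) M

  []-both : ∀ {n} {M M′ : Comp (suc n)} {V V′ : Val n} →
            M ⟶[ R ]* M′ → V ⟶ᵛ[ R ]* V′ → M [ V ] ⟶[ R ]* M′ [ V′ ]
  []-both {M′ = M′} p q = subC-steps _ p ◅◅ []-argument M′ q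

data Assoc {n : ℕ} : Comp n → Comp n → Set where
  ass : ∀ (L : Comp n) (M : Comp (suc n)) (N : Comp (suc n)) →
        Assoc ((L ⋆ (ƛ M)) ⋆ (ƛ N)) (L ⋆ (ƛ (M ⋆ (ƛ renC skip1 N))))

data BetaId {n : ℕ} : Comp n → Comp n → Set where
  βc : ∀ (V : Val n) (M : Comp (suc n)) → BetaId (unit V ⋆ (ƛ M)) (M [ V ])
  id : ∀ (M : Comp n) → BetaId (M ⋆ (ƛ unit (var zero))) M

Assoc-subst : SubstClosed Assoc
Assoc-subst σ (ass L M N) =
  subst (λ N′ → Assoc (subC σ ((L ⋆ ƛ M) ⋆ ƛ N)) (subC σ L ⋆ (ƛ (subC (liftS σ) M ⋆ (ƛ N′)))))
        (sym (subC-skip1 σ N)) (ass _ _ _)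

BetaId-subst : SubstClosed BetaId
BetaId-subst σ (βc V M) = subst (BetaId _) (sym (subC-[] σ V M)) (βc _ _)
BetaId-subst σ (id M)   = id _

module AssocSubst = SubstClosure Assoc-subst
open SubstClosure BetaId-subst using (subC-steps; renC-step; []-argument; []-both)

mutual
  split : ∀ {n} {M N : Comp n} → M ⟶ N → Compat Assoc M N ⊎ Compat BetaId M N
  split (root (_↦_.βc V M))    = inj₂ (root (βc V M))
  split (root (_↦_.id M))      = inj₂ (root (id M))
  split (root (_↦_.ass L M N)) = inj₁ (root (ass L M N))
  split (unitV s) = Sum.map unitV unitV (splitᵛ s)
  split (⋆L s)    = Sum.map ⋆L ⋆L (split s)
  split (⋆R s)    = Sum.map ⋆R ⋆R (splitᵛ s)

  splitᵛ : ∀ {n} {V W : Val n} → V ⟶V W → Compatᵛ Assoc V W ⊎ Compatᵛ BetaId V W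
  splitᵛ (ƛcong s) = Sum.map ƛcong ƛcong (split s)

Assoc⊆↦ : ∀ {n} {M N : Comp n} → Assoc M N → M ↦ N
Assoc⊆↦ (ass L M N) = _↦_.ass L M N

BetaId⊆↦ : ∀ {n} {M N : Comp n} → BetaId M N → M ↦ N
BetaId⊆↦ (βc V M) = _↦_.βc V M
BetaId⊆↦ (id M)   = _↦_.id M

module _ {R : RootRel} (R⊆↦ : ∀ {n} {M N : Comp n} → R M N → M ↦ N) where
  mutual
    embed : ∀ {n} {M N : Comp n} → Compat R M N → M ⟶ N
    embed (root r)  = root (R⊆↦ r)
    embed (unitV s) = unitV (embedᵛ s)
    embed (⋆L s)    = ⋆L (embed s)
    embed (⋆R s)    = ⋆R (embedᵛ s)

    embedᵛ : ∀ {n} {V W : Val n} → Compatᵛ R V W → V ⟶V W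
    embedᵛ (ƛcong s) = ƛcong (embed s)

-- Confluence of associativity

-- X ⋆ⁿ V is the associativity normal form of X ⋆ V when X and V are normal:
-- the new binder is pushed down the right spine of X.
infixl 5 _⋆ⁿ_

_⋆ⁿ_ : ∀ {n} → Comp n → Val n → Comp n
unit W ⋆ⁿ V           = unit W ⋆ V
(K ⋆ var i) ⋆ⁿ V      = (K ⋆ var i) ⋆ V
(K ⋆ ƛ P) ⋆ⁿ var i    = (K ⋆ ƛ P) ⋆ var i
(K ⋆ ƛ P) ⋆ⁿ ƛ Q      = K ⋆ ƛ (P ⋆ⁿ ƛ renC skip1 Q)

mutual
  nfC : ∀ {n} → Comp n → Comp n
  nfC (unit V) = unit (nfV V)
  nfC (M ⋆ V)  = nfC M ⋆ⁿ nfV V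

  nfV : ∀ {n} → Val n → Val n
  nfV (var i) = var i
  nfV (ƛ M)   = ƛ nfC M

renC-⋆ⁿ : ∀ {m n} (ρ : Ren m n) X V → renC ρ (X ⋆ⁿ V) ≡ renC ρ X ⋆ⁿ renV ρ V
renC-⋆ⁿ ρ (unit W) V        = refl
renC-⋆ⁿ ρ (K ⋆ var i) V     = refl
renC-⋆ⁿ ρ (K ⋆ ƛ P) (var i) = refl
renC-⋆ⁿ ρ (K ⋆ ƛ P) (ƛ Q)   = cong (λ B → renC ρ K ⋆ ƛ B)
  (trans (renC-⋆ⁿ (liftR ρ) P (ƛ renC skip1 Q))
         (cong (λ Q′ → renC (liftR ρ) P ⋆ⁿ ƛ Q′) (renC-skip1 ρ Q)))

mutual
  nfC-renC : ∀ {m n} (ρ : Ren m n) M → nfC (renC ρ M) ≡ renC ρ (nfC M)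
  nfC-renC ρ (unit V) = cong unit (nfV-renV ρ V)
  nfC-renC ρ (M ⋆ V)  =
    trans (cong₂ _⋆ⁿ_ (nfC-renC ρ M) (nfV-renV ρ V)) (sym (renC-⋆ⁿ ρ (nfC M) (nfV V)))

  nfV-renV : ∀ {m n} (ρ : Ren m n) V → nfV (renV ρ V) ≡ renV ρ (nfV V)
  nfV-renV ρ (var i) = refl
  nfV-renV ρ (ƛ M)   = cong ƛ_ (nfC-renC (liftR ρ) M)

⋆ⁿ-assoc : ∀ {n} (X : Comp n) P Q → (X ⋆ⁿ ƛ P) ⋆ⁿ ƛ Q ≡ X ⋆ⁿ ƛ (P ⋆ⁿ ƛ renC skip1 Q)
⋆ⁿ-assoc (unit W) P Q    = refl
⋆ⁿ-assoc (K ⋆ var i) P Q = refl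
⋆ⁿ-assoc (K ⋆ ƛ R) P Q   = cong (λ B → K ⋆ ƛ B) (begin
  (R ⋆ⁿ ƛ renC skip1 P) ⋆ⁿ ƛ renC skip1 Q                      ≡⟨ ⋆ⁿ-assoc R (renC skip1 P) (renC skip1 Q) ⟩
  R ⋆ⁿ ƛ (renC skip1 P ⋆ⁿ ƛ renC skip1 (renC skip1 Q))         ≡⟨ cong (λ Q′ → R ⋆ⁿ ƛ (renC skip1 P ⋆ⁿ ƛ Q′)) (renC-skip1 suc Q) ⟨
  R ⋆ⁿ ƛ (renC skip1 P ⋆ⁿ ƛ renC (liftR skip1) (renC skip1 Q)) ≡⟨ cong (λ B → R ⋆ⁿ ƛ B) (renC-⋆ⁿ skip1 P (ƛ renC skip1 Q)) ⟨
  R ⋆ⁿ ƛ renC skip1 (P ⋆ⁿ ƛ renC skip1 Q)                      ∎)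
  where open ≡-Reasoning

⋆ⁿ-reachable : ∀ {n} (X : Comp n) V → X ⋆ V ⟶[ Assoc ]* X ⋆ⁿ V
⋆ⁿ-reachable (unit W) V        = ε
⋆ⁿ-reachable (K ⋆ var i) V     = ε
⋆ⁿ-reachable (K ⋆ ƛ P) (var i) = ε
⋆ⁿ-reachable (K ⋆ ƛ P) (ƛ Q)   = root (ass K P Q) ◅ ⋆R* (ƛ* (⋆ⁿ-reachable P (ƛ renC skip1 Q)))

mutual
  nfC-reachable : ∀ {n} (M : Comp n) → M ⟶[ Assoc ]* nfC M
  nfC-reachable (unit V) = unit* (nfV-reachable V)
  nfC-reachable (M ⋆ V)  = ⋆* (nfC-reachable M) (nfV-reachable V) ◅◅ ⋆ⁿ-reachable (nfC M) (nfV V)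

  nfV-reachable : ∀ {n} (V : Val n) → V ⟶ᵛ[ Assoc ]* nfV V
  nfV-reachable (var i) = ε
  nfV-reachable (ƛ M)   = ƛ* (nfC-reachable M)

mutual
  nfC-invariant : ∀ {n} {M M′ : Comp n} → Compat Assoc M M′ → nfC M ≡ nfC M′
  nfC-invariant (root (ass L M N)) =
    trans (⋆ⁿ-assoc (nfC L) (nfC M) (nfC N))
          (cong (λ N′ → nfC L ⋆ⁿ ƛ (nfC M ⋆ⁿ ƛ N′)) (sym (nfC-renC skip1 N)))
  nfC-invariant (unitV s)        = cong unit (nfV-invariant s)
  nfC-invariant (⋆L {V = V} s)   = cong (_⋆ⁿ nfV V) (nfC-invariant s)
  nfC-invariant (⋆R {M} s)       = cong (nfC M ⋆ⁿ_) (nfV-invariant s)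

  nfV-invariant : ∀ {n} {V V′ : Val n} → Compatᵛ Assoc V V′ → nfV V ≡ nfV V′
  nfV-invariant (ƛcong s) = cong ƛ_ (nfC-invariant s)

Assoc-confluent : ∀ {n} → Confluent (Compat Assoc {n})
Assoc-confluent = confluent-by-normal-form nfC nfC-reachable nfC-invariant

-- Confluence of β_c ∪ id

isIdBody : ∀ {n} → Comp (suc n) → Bool
isIdBody (unit (var zero))    = true
isIdBody (unit (var (suc i))) = false
isIdBody (unit (ƛ M))         = false
isIdBody (M ⋆ V)              = false

-- The complete development, contracting every β_c- and id-redex at once.
-- On the overlap  unit U ⋆ ƛ unit x  the id-contraction is chosen; the
-- β_c-contraction has the same result.
mutual
  devC : ∀ {n} → Comp n → Comp n
  devC (unit V)    = unit (devV V)
  devC (M ⋆ var i) = devC M ⋆ var i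
  devC (M ⋆ ƛ P)   = devBind (isIdBody P) M P

  devV : ∀ {n} → Val n → Val n
  devV (var i) = var i
  devV (ƛ M)   = ƛ devC M

  devBind : ∀ {n} → Bool → Comp n → Comp (suc n) → Comp n
  devBind true  M P = devC M
  devBind false M P = devβ M P

  devβ : ∀ {n} → Comp n → Comp (suc n) → Comp n
  devβ (unit U) P = devC P [ devV U ]
  devβ (K ⋆ W)  P = devC (K ⋆ W) ⋆ ƛ devC P

data IdBodyView {n : ℕ} : Comp (suc n) → Set where
  idBody    : IdBodyView (unit (var zero))
  nonIdBody : ∀ {P} → isIdBody P ≡ false → IdBodyView P

idBodyView : ∀ {n} (P : Comp (suc n)) → IdBodyView P
idBodyView (unit (var zero))    = idBody
idBodyView (unit (var (suc i))) = nonIdBody refl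
idBodyView (unit (ƛ M))         = nonIdBody refl
idBodyView (M ⋆ V)              = nonIdBody refl

devC-nonId : ∀ {n} {M : Comp n} {P} → isIdBody P ≡ false → devC (M ⋆ ƛ P) ≡ devβ M P
devC-nonId {P = P} e with isIdBody P
devC-nonId refl | false = refl

devC-β : ∀ {n} (U : Val n) P → devC (unit U ⋆ ƛ P) ≡ devC P [ devV U ]
devC-β U P with idBodyView P
... | idBody      = refl
... | nonIdBody e = devC-nonId e

isIdBody-renC : ∀ {m n} (ρ : Ren m n) (P : Comp (suc m)) → isIdBody (renC (liftR ρ) P) ≡ isIdBody P
isIdBody-renC ρ (unit (var zero))    = refl
isIdBody-renC ρ (unit (var (suc i))) = refl
isIdBody-renC ρ (unit (ƛ M))         = refl
isIdBody-renC ρ (M ⋆ V)              = refl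

unit-var-irreducible : ∀ {n} {i : Fin n} {Q} → Compat BetaId (unit (var i)) Q → ⊥
unit-var-irreducible (root ())
unit-var-irreducible (unitV ())

_⟶β*_ : ∀ {n} → Comp n → Comp n → Set
M ⟶β* M′ = M ⟶[ BetaId ]* M′

_⟶βᵛ*_ : ∀ {n} → Val n → Val n → Set
V ⟶βᵛ* V′ = V ⟶ᵛ[ BetaId ]* V′

infix 4 _⟶β*_ _⟶βᵛ*_

devC-⋆ : ∀ {n} (M : Comp n) V → devC M ⋆ devV V ⟶β* devC (M ⋆ V)
devC-⋆ M (var i) = ε
devC-⋆ M (ƛ P) with idBodyView P
... | idBody      = return (root (id (devC M)))
... | nonIdBody e = contract M ◅◅ ≡⇒⟶* (sym (devC-nonId e))
  where
  contract : ∀ M → devC M ⋆ ƛ devC P ⟶β* devβ M P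
  contract (unit U) = return (root (βc (devV U) (devC P)))
  contract (K ⋆ W)  = ε

mutual
  devC-reachable : ∀ {n} (M : Comp n) → M ⟶β* devC M
  devC-reachable (unit V) = unit* (devV-reachable V)
  devC-reachable (M ⋆ V)  = ⋆* (devC-reachable M) (devV-reachable V) ◅◅ devC-⋆ M V

  devV-reachable : ∀ {n} (V : Val n) → V ⟶βᵛ* devV V
  devV-reachable (var i) = ε
  devV-reachable (ƛ M)   = ƛ* (devC-reachable M)

mutual
  devC-renC : ∀ {m n} (ρ : Ren m n) (M : Comp m) → devC (renC ρ M) ≡ renC ρ (devC M)
  devC-renC ρ (unit V)    = cong unit (devV-renV ρ V)
  devC-renC ρ (M ⋆ var i) = cong (_⋆ var (ρ i)) (devC-renC ρ M)
  devC-renC ρ (M ⋆ ƛ P) with idBodyView P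
  ... | idBody      = devC-renC ρ M
  ... | nonIdBody e =
    trans (devC-nonId (trans (isIdBody-renC ρ P) e))
          (trans (devβ-renC M) (cong (renC ρ) (sym (devC-nonId e))))
    where
    devβ-renC : ∀ M → devβ (renC ρ M) (renC (liftR ρ) P) ≡ renC ρ (devβ M P)
    devβ-renC (unit U) = trans (cong₂ (λ U′ P′ → P′ [ U′ ]) (devV-renV ρ U) (devC-renC (liftR ρ) P))
                               (sym (renC-[] ρ (devV U) (devC P)))
    devβ-renC (K ⋆ W)  = cong₂ _⋆_ (devC-renC ρ (K ⋆ W)) (cong ƛ_ (devC-renC (liftR ρ) P))

  devV-renV : ∀ {m n} (ρ : Ren m n) (V : Val m) → devV (renV ρ V) ≡ renV ρ (devV V)
  devV-renV ρ (var i) = refl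
  devV-renV ρ (ƛ M)   = cong ƛ_ (devC-renC (liftR ρ) M)

liftS-devV : ∀ {m n} (σ : Sub m n) → liftS (devV ∘ σ) ≗ devV ∘ liftS σ
liftS-devV σ zero    = refl
liftS-devV σ (suc i) = sym (devV-renV suc (σ i))

mutual
  devC-subC : ∀ {m n} (σ : Sub m n) (M : Comp m) → subC (devV ∘ σ) (devC M) ⟶β* devC (subC σ M)
  devC-subC σ (unit V)    = unit* (devV-subV σ V)
  devC-subC σ (M ⋆ var i) = ⋆L* (devC-subC σ M) ◅◅ devC-⋆ (subC σ M) (σ i)
  devC-subC σ (M ⋆ ƛ P) with idBodyView P
  ... | idBody      = devC-subC σ M
  ... | nonIdBody e = ≡⇒⟶* (cong (subC (devV ∘ σ)) (devC-nonId e)) ◅◅ devβ-subC M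
    where
    body : subC (liftS (devV ∘ σ)) (devC P) ⟶β* devC (subC (liftS σ) P)
    body = ≡⇒⟶* (subC-ext (liftS-devV σ) (devC P)) ◅◅ devC-subC (liftS σ) P

    devβ-subC : ∀ M → subC (devV ∘ σ) (devβ M P) ⟶β* devC (subC σ (M ⋆ ƛ P))
    devβ-subC (unit U) =
      ≡⇒⟶* (subC-[] (devV ∘ σ) (devV U) (devC P))
      ◅◅ []-both body (devV-subV σ U)
      ◅◅ ≡⇒⟶* (sym (devC-β (subV σ U) (subC (liftS σ) P)))
    devβ-subC (K ⋆ W) = ⋆* (devC-subC σ (K ⋆ W)) (ƛ* body) ◅◅ devC-⋆ (subC σ (K ⋆ W)) (ƛ subC (liftS σ) P)

  devV-subV : ∀ {m n} (σ : Sub m n) (V : Val m) → subV (devV ∘ σ) (devV V) ⟶βᵛ* devV (subV σ V)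
  devV-subV σ (var i) = ε
  devV-subV σ (ƛ M)   = ƛ* (≡⇒⟶* (subC-ext (liftS-devV σ) (devC M)) ◅◅ devC-subC (liftS σ) M)

devC-[] : ∀ {n} (N : Comp (suc n)) (W : Val n) → devC N [ devV W ] ⟶β* devC (N [ W ])
devC-[] N W = ≡⇒⟶* (subC-ext (λ { zero → refl ; (suc i) → refl }) (devC N)) ◅◅ devC-subC (single W) N

mutual
  devC-mono : ∀ {n} {M N : Comp n} → Compat BetaId M N → devC M ⟶β* devC N
  devC-mono (root (βc W N))      = ≡⇒⟶* (devC-β W N) ◅◅ devC-[] N W
  devC-mono (root (id M))        = ε
  devC-mono (unitV s)            = unit* (devV-mono s)
  devC-mono (⋆L {V = var i} s)   = ⋆L* (devC-mono s)
  devC-mono (⋆L {M} {M′} {ƛ P} s) with idBodyView P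
  ... | idBody      = devC-mono s
  ... | nonIdBody e = ≡⇒⟶* (devC-nonId e) ◅◅ devβ-mono s
    where
    devβ-mono : ∀ {M M′} → Compat BetaId M M′ → devβ M P ⟶β* devC (M′ ⋆ ƛ P)
    devβ-mono {unit U} (root ())
    devβ-mono {unit U} (unitV s′) = []-argument (devC P) (devV-mono s′) ◅◅ ≡⇒⟶* (sym (devC-β _ P))
    devβ-mono {K ⋆ W}  s′         = ⋆L* (devC-mono s′) ◅◅ devC-⋆ _ (ƛ P)
  devC-mono (⋆R {M} (ƛcong {P} {P′} s)) with idBodyView P
  ... | idBody      = ⊥-elim (unit-var-irreducible s)
  ... | nonIdBody e = ≡⇒⟶* (devC-nonId e) ◅◅ devβ-mono M
    where
    devβ-mono : ∀ M → devβ M P ⟶β* devC (M ⋆ ƛ P′)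
    devβ-mono (unit U) = subC-steps _ (devC-mono s) ◅◅ ≡⇒⟶* (sym (devC-β U P′))
    devβ-mono (K ⋆ W)  = ⋆R* (ƛ* (devC-mono s)) ◅◅ devC-⋆ (K ⋆ W) (ƛ P′)

  devV-mono : ∀ {n} {V W : Val n} → Compatᵛ BetaId V W → devV V ⟶βᵛ* devV W
  devV-mono (ƛcong s) = ƛ* (devC-mono s)

mutual
  devC-triangle : ∀ {n} {M N : Comp n} → Compat BetaId M N → N ⟶β* devC M
  devC-triangle (root (βc W N)) =
    []-both (devC-reachable N) (devV-reachable W) ◅◅ ≡⇒⟶* (sym (devC-β W N))
  devC-triangle (root (id M))      = devC-reachable M
  devC-triangle (unitV s)          = unit* (devV-triangle s)
  devC-triangle (⋆L {V = var i} s) = ⋆L* (devC-triangle s)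
  devC-triangle (⋆L {M} {M′} {ƛ P} s) with idBodyView P
  ... | idBody      = return (root (id M′)) ◅◅ devC-triangle s
  ... | nonIdBody e = devβ-triangle s ◅◅ ≡⇒⟶* (sym (devC-nonId e))
    where
    devβ-triangle : ∀ {M M′} → Compat BetaId M M′ → M′ ⋆ ƛ P ⟶β* devβ M P
    devβ-triangle {unit U} (root ())
    devβ-triangle {unit U} (unitV {V′ = U′} s′) =
      return (root (βc U′ P)) ◅◅ []-both (devC-reachable P) (devV-triangle s′)
    devβ-triangle {K ⋆ W} s′ = ⋆* (devC-triangle s′) (ƛ* (devC-reachable P))
  devC-triangle (⋆R {M} (ƛcong {P} {P′} s)) with idBodyView P
  ... | idBody      = ⊥-elim (unit-var-irreducible s)
  ... | nonIdBody e = devβ-triangle M ◅◅ ≡⇒⟶* (sym (devC-nonId e))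
    where
    devβ-triangle : ∀ M → M ⋆ ƛ P′ ⟶β* devβ M P
    devβ-triangle (unit U) = return (root (βc U P′)) ◅◅ []-both (devC-triangle s) (devV-reachable U)
    devβ-triangle (K ⋆ W)  = ⋆* (devC-reachable (K ⋆ W)) (ƛ* (devC-triangle s))

  devV-triangle : ∀ {n} {V W : Val n} → Compatᵛ BetaId V W → W ⟶βᵛ* devV V
  devV-triangle (ƛcong s) = ƛ* (devC-triangle s)

BetaId-confluent : ∀ {n} → Confluent (Compat BetaId {n})
BetaId-confluent = z-property⇒confluent devC (λ s → devC-triangle s , devC-mono s)

-- Commutation and confluence of the union

StripJoin : ∀ {n} → Comp n → Comp n → Set
StripJoin M N = ∃ λ P → Compat BetaId M P × N ⟶[ Assoc ]* P

StripJoinᵛ : ∀ {n} → Val n → Val n → Set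
StripJoinᵛ V W = ∃ λ U → Compatᵛ BetaId V U × W ⟶ᵛ[ Assoc ]* U

assocRoot-betaId : ∀ {n} {M M′ N : Comp n} → Assoc M M′ → Compat BetaId M N → StripJoin M′ N
assocRoot-betaId () (root (βc W N))
assocRoot-betaId (ass L M _) (root (id _)) = L ⋆ ƛ M , ⋆R (ƛcong (root (id M))) , ε
assocRoot-betaId (ass L M N) (⋆L (root (βc U _))) =
  M [ U ] ⋆ ƛ N ,
  subst (λ N′ → Compat BetaId (unit U ⋆ ƛ (M ⋆ ƛ renC skip1 N)) (M [ U ] ⋆ ƛ N′))
        (liftS-single-skip1 U N) (root (βc U (M ⋆ ƛ renC skip1 N))) ,
  ε
assocRoot-betaId (ass L _ N) (⋆L (root (id _))) =
  L ⋆ ƛ N ,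
  subst (λ N′ → Compat BetaId (L ⋆ ƛ (unit (var zero) ⋆ ƛ renC skip1 N)) (L ⋆ ƛ N′))
        (skip1-[var0] N) (⋆R (ƛcong (root (βc (var zero) (renC skip1 N))))) ,
  ε
assocRoot-betaId (ass L M N) (⋆L (⋆L {M′ = L′} s)) =
  L′ ⋆ ƛ (M ⋆ ƛ renC skip1 N) , ⋆L s , return (root (ass L′ M N))
assocRoot-betaId (ass L M N) (⋆L (⋆R (ƛcong {M′ = M′} s))) =
  L ⋆ ƛ (M′ ⋆ ƛ renC skip1 N) , ⋆R (ƛcong (⋆L s)) , return (root (ass L M′ N))
assocRoot-betaId (ass L M N) (⋆R (ƛcong {M′ = N′} s)) =
  L ⋆ ƛ (M ⋆ ƛ renC skip1 N′) , ⋆R (ƛcong (⋆R (ƛcong (renC-step skip1 s)))) ,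
  return (root (ass L M N′))

assoc-betaIdRoot : ∀ {n} {M M′ N : Comp n} → Compat Assoc M M′ → BetaId M N → StripJoin M′ N
assoc-betaIdRoot (root a) b = assocRoot-betaId a (root b)
assoc-betaIdRoot (⋆L (unitV {V′ = W′} s)) (βc W N) =
  N [ W′ ] , root (βc W′ N) , AssocSubst.[]-argument N (return s)
assoc-betaIdRoot (⋆R (ƛcong {M′ = N′} s)) (βc W N) =
  N′ [ W ] , root (βc W N′) , return (AssocSubst.subC-step (single W) s)
assoc-betaIdRoot (⋆L {M′ = M′} s) (id M) = M′ , root (id M′) , return s
assoc-betaIdRoot (⋆R (ƛcong (root ()))) (id M)
assoc-betaIdRoot (⋆R (ƛcong (unitV ()))) (id M)

mutual
  assoc-betaId-strip : ∀ {n} {M M′ N : Comp n} → Compat Assoc M M′ → Compat BetaId M N → StripJoin M′ N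
  assoc-betaId-strip (root a) s = assocRoot-betaId a s
  assoc-betaId-strip a (root b) = assoc-betaIdRoot a b
  assoc-betaId-strip (unitV a) (unitV b) =
    let U , s , p = assoc-betaId-stripᵛ a b in unit U , unitV s , unit* p
  assoc-betaId-strip (⋆L a) (⋆L b) =
    let P , s , p = assoc-betaId-strip a b in P ⋆ _ , ⋆L s , ⋆L* p
  assoc-betaId-strip (⋆R {V′ = V′} a) (⋆L {M′ = M′} b) = M′ ⋆ V′ , ⋆L b , return (⋆R a)
  assoc-betaId-strip (⋆L {M′ = M′} a) (⋆R {V′ = V′} b) = M′ ⋆ V′ , ⋆R b , return (⋆L a)
  assoc-betaId-strip (⋆R a) (⋆R b) =
    let U , s , p = assoc-betaId-stripᵛ a b in _ ⋆ U , ⋆R s , ⋆R* p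

  assoc-betaId-stripᵛ : ∀ {n} {V V′ W : Val n} → Compatᵛ Assoc V V′ → Compatᵛ BetaId V W → StripJoinᵛ V′ W
  assoc-betaId-stripᵛ (ƛcong a) (ƛcong b) =
    let P , s , p = assoc-betaId-strip a b in ƛ P , ƛcong s , ƛ* p

Assoc-BetaId-commute : ∀ {n} → Commute (Compat Assoc {n}) (Compat BetaId)
Assoc-BetaId-commute = commute-by-strip assoc-betaId-strip

⟶-confluent : ∀ {n} → Confluent (_⟶_ {n})
⟶-confluent =
  confluent-between split [ return ∘ embed Assoc⊆↦ , return ∘ embed BetaId⊆↦ ]
    (hindley-rosen Assoc-confluent BetaId-confluent Assoc-BetaId-commute)

mainTheorem1 : ∀ {n : ℕ} (M N L : Comp n) → M ⟶* N → M ⟶* L →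
    ∃ λ (M' : Comp n) → (N ⟶* M') × (L ⟶* M')
mainTheorem1 _ _ _ = ⟶-confluent
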